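{- Let $G$ be a finite, connected graph without loops. Fix a nonempty subset $Z\subseteq V(G)$ and an arithmetical structure $(\mathbf{d},\mathbf{r})$ on $G$. If each divisor on $G$ is equivalent (with respect to $\mathbf{d}$) to a divisor that is nonzero only at vertices in $Z$, then the critical group $\mathcal{K}(G;\mathbf{d},\mathbf{r})$ has at most $|Z|-1$ invariant factors.
   Context: Let $A(G)$ be the adjacency matrix of $G$. An arithmetical structure on $G$ is a pair $(\mathbf{d},\mathbf{r})$ with $\mathbf{d}\in\mathbb{Z}_{\ge0}^{V(G)}$, $\mathbf{r}\in\mathbb{Z}_{>0}^{V(G)}$ whose entries have no nontrivial common factor, and $(\operatorname{diag}(\mathbf{d})-A(G))\mathbf{r}=\mathbf{0}$. Write $L(G,\mathbf{d})=\operatorname{diag}(\mathbf{d})-A(G)$. The critical group $\mathcal{K}(G;\mathbf{d},\mathbf{r})$ is the torsion subgroup of the cokernel $\mathbb{Z}^{V(G)}/\operatorname{im}L(G,\mathbf{d})$ (this cokernel is isomorphic to $\mathbb{Z}\oplus\mathcal{K}(G;\mathbf{d},\mathbf{r})$). The number of invariant factors of a finite abelian group is the number of nontrivial cyclic factors in its invariant factor decomposition. A divisor is a vector $\delta\in\mathbb{Z}^{V(G)}$; two divisors are equivalent with respect to $\mathbf{d}$ if their difference lies in the image of $L(G,\mathbf{d})$ as a map $\mathbb{Z}^{V(G)}\to\mathbb{Z}^{V(G)}$ (i.e., one is obtained from the other by firing, which subtracts a column of $L(G,\mathbf{d})$, and borrowing, which adds one). -}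

module Defs where

open import Data.Nat as ℕ using (ℕ; zero; suc)
open import Data.Nat.Divisibility using () renaming (_∣_ to _∣ℕ_)
open import Data.Integer as ℤ using (ℤ; +_; _+_; _-_; _*_)
open import Data.Integer.Divisibility using () renaming (_∣_ to _∣ℤ_)
open import Data.Fin using (Fin; zero; suc; _≤_)
open import Data.Fin.Subset using (Subset; _∉_)
open import Data.Product using (Σ; ∃; ∃-syntax; _,_; _×_; proj₁)
open import Relation.Binary.PropositionalEquality using (_≡_)

sumℤ : ∀ {n} → (Fin n → ℤ) → ℤ
sumℤ {zero}  f = + 0
sumℤ {suc n} f = f zero + sumℤ (λ i → f (suc i))

-- A finite loopless (multi)graph on vertex set Fin n, given by its
-- adjacency matrix (entry = number of edges between u and v).
record Graph (n : ℕ) : Set where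
  field
    adj       : Fin n → Fin n → ℕ
    symmetric : ∀ u v → adj u v ≡ adj v u
    loopless  : ∀ v → adj v v ≡ 0
open Graph public

data Reach {n : ℕ} (G : Graph n) : Fin n → Fin n → Set where
  here : ∀ {v} → Reach G v v
  step : ∀ {u v w} → 0 ℕ.< adj G u v → Reach G v w → Reach G u w

Connected : ∀ {n} → Graph n → Set
Connected {n} G = ∀ (u v : Fin n) → Reach G u v

L : ∀ {n} → Graph n → (Fin n → ℕ) → (Fin n → ℤ) → (Fin n → ℤ)
L G d x v = (+ d v) * x v - sumℤ (λ u → (+ adj G v u) * x u)

record IsArithmetical {n} (G : Graph n) (d r : Fin n → ℕ) : Set where
  field
    r-pos     : ∀ v → 0 ℕ.< r v
    r-prim    : ∀ (m : ℕ) → (∀ v → m ∣ℕ r v) → m ≡ 1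
    kernel    : ∀ v → L G d (λ u → + r u) v ≡ + 0

InIm : ∀ {n} → Graph n → (Fin n → ℕ) → (Fin n → ℤ) → Set
InIm {n} G d δ = ∃[ x ] (∀ (v : Fin n) → δ v ≡ L G d x v)

_≈[_,_]_ : ∀ {n} → (Fin n → ℤ) → Graph n → (Fin n → ℕ) → (Fin n → ℤ) → Set
δ ≈[ G , d ] δ' = InIm G d (λ v → δ v - δ' v)

SupportedOn : ∀ {n} → (Fin n → ℤ) → Subset n → Set
SupportedOn {n} δ Z = ∀ (v : Fin n) → v ∉ Z → δ v ≡ + 0

-- Critical group K(G;d,r): torsion subgroup of ℤ^V / im L(G,d),
-- presented as a setoid: torsion representatives modulo im L.
Crit : ∀ {n} → Graph n → (Fin n → ℕ) → Set
Crit {n} G d = Σ (Fin n → ℤ) λ δ → ∃[ k ] InIm G d (λ v → (+ suc k) * δ v)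

CritEq : ∀ {n} (G : Graph n) d → Crit G d → Crit G d → Set
CritEq G d (δ , _) (δ' , _) = δ ≈[ G , d ] δ'

-- the product ℤ/a₁ × ... × ℤ/a_k as a setoid on ℤ^k
_≈[_]_ : ∀ {k} → (Fin k → ℤ) → (Fin k → ℕ) → (Fin k → ℤ) → Set
_≈[_]_ {k} x a y = ∀ (i : Fin k) → (+ a i) ∣ℤ (x i - y i)

IsInvariantFactors : ∀ {k} → (Fin k → ℕ) → Set
IsInvariantFactors {k} a = (∀ (i : Fin k) → 1 ℕ.< a i) × (∀ (i j : Fin k) → i ≤ j → a i ∣ℕ a j)

-- group isomorphism K(G;d,r) ≅ ℤ/a₁ × ... × ℤ/a_k
-- (additivity stated relationally: whenever z = x + y in K)
record CritIso {n k} (G : Graph n) (d : Fin n → ℕ) (a : Fin k → ℕ) : Set where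
  field
    f     : Crit G d → (Fin k → ℤ)
    resp  : ∀ x y → CritEq G d x y → f x ≈[ a ] f y
    hom   : ∀ (x y z : Crit G d) → (∀ v → proj₁ z v ≡ proj₁ x v + proj₁ y v) →
              f z ≈[ a ] (λ i → f x i + f y i)
    inj   : ∀ x y → f x ≈[ a ] f y → CritEq G d x y
    surj  : ∀ (w : Fin k → ℤ) → ∃[ x ] (f x ≈[ a ] w)

module Submission where

-- Reduce modulo a prime p dividing every invariant factor (any prime when k = 0).
-- The cokernel ℤ^V / im L(G,d) is ℤ ⊕ K, and it contains k + 1 classes that are
-- independent modulo p: the unit divisor e_v at a vertex v with p ∤ r_v, detected by
-- the functional δ ↦ Σ_v r_v δ_v (which vanishes on im L by self-adjointness of L and
-- on torsion), and lifts of the k cyclic generators of K, detected through the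
-- isomorphism. If every class has a representative supported on Z, then any |Z| + 1
-- classes are dependent modulo p by Gaussian elimination over 𝔽_p. Hence k + 1 ≤ |Z|.

open import Defs
open import Data.Nat using (ℕ; _≤_; _∸_)
open import Data.Nat.Properties using (∸-monoˡ-≤)
open import Data.Integer using (ℤ)
open import Data.Fin using (Fin)
open import Data.Fin.Subset using (Subset; Nonempty; ∣_∣)
open import Data.Product using (∃-syntax; _×_)

-- Kept out of the top-level scope, where _,_ would make δ ≈[ G , d ] δ' ambiguous.
module _ where

  open import Data.Nat as ℕ using (zero; suc; s≤s; z≤n; NonZero)
  import Data.Nat.Properties as ℕP
  import Data.Nat.Divisibility as ℕ∣
  open import Data.Nat.Primality using (Prime; euclidsLemma; ¬prime[1]; prime[2]; prime⇒nonZero)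
  open import Data.Nat.Primality.Factorisation using (factorise)
  open import Data.List.Base using ([]; _∷_)
  open import Data.List.Relation.Unary.All using (_∷_)
  open import Data.Integer as ℤ using (+_; -[1+_]; _+_; _-_; _*_; -_)
  import Data.Integer.Properties as ℤP
  open import Data.Integer.Divisibility.Signed
    using (_∣_; divides; _∣?_; ∣ᵤ⇒∣; ∣⇒∣ᵤ; ∣-trans; ∣m∣n⇒∣m+n; ∣n⇒∣m*n; ∣m⇒∣-m)
  open import Data.Integer.Tactic.RingSolver using (solve-∀)
  open import Algebra.Properties.Semiring.Sum ℤP.+-*-semiring
    using (sum-syntax; sum-cong-≗; sum-replicate-zero; ∑-distrib-+; ∑-comm; sum-remove;
           *-distribˡ-sum; *-distribʳ-sum)
  open import Data.Fin as Fin using (zero; suc; punchIn)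
  import Data.Fin.Properties as FinP
  open import Data.Fin.Subset using (inside; outside)
  open import Data.Fin.Subset.Properties using (drop-there)
  open import Data.Vec using (_∷_; [])
  open import Data.Vec.Functional using (insertAt)
  open import Data.Vec.Functional.Properties using (insertAt-lookup; insertAt-punchIn)
  open import Data.Product using (Σ; _,_; proj₁; proj₂)
  open import Data.Sum using (_⊎_; inj₁; inj₂; [_,_])
  open import Data.Empty using (⊥-elim)
  open import Relation.Nullary using (¬_; yes; no)
  open import Relation.Binary using (IsEquivalence; Setoid)
  open import Relation.Binary.PropositionalEquality
    using (_≡_; _≢_; refl; sym; trans; cong; cong₂; subst; _≗_; module ≡-Reasoning)
  open import Function using (_∘_; id)

  -- Congruences modulo q

  infix 4 _≡_[mod_]

  -- A record rather than a synonym for q ∣ x - y, so that x and y can be inferred.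
  record _≡_[mod_] (x y q : ℤ) : Set where
    constructor mod-∣
    field ∣-difference : q ∣ x - y


  module _ {q : ℤ} where

    private
      by : ∀ {z x y} → z ≡ x - y → q ∣ z → x ≡ y [mod q ]
      by eq q∣ = mod-∣ (subst (q ∣_) eq q∣)

    ≡[mod]-reflexive : ∀ {x y} → x ≡ y → x ≡ y [mod q ]
    ≡[mod]-reflexive {x} refl = mod-∣ (divides (+ 0) (trans (ℤP.+-inverseʳ x) (sym (ℤP.*-zeroˡ q))))

    ≡[mod]-sym : ∀ {x y} → x ≡ y [mod q ] → y ≡ x [mod q ]
    ≡[mod]-sym {x} {y} (mod-∣ q∣) = by (lemma x y) (∣m⇒∣-m q∣)
      where lemma : ∀ x y → - (x - y) ≡ y - x
            lemma = solve-∀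

    ≡[mod]-trans : ∀ {x y z} → x ≡ y [mod q ] → y ≡ z [mod q ] → x ≡ z [mod q ]
    ≡[mod]-trans {x} {y} {z} (mod-∣ q∣₁) (mod-∣ q∣₂) = by (lemma x y z) (∣m∣n⇒∣m+n q∣₁ q∣₂)
      where lemma : ∀ x y z → (x - y) + (y - z) ≡ x - z
            lemma = solve-∀

    ≡[mod]-isEquivalence : IsEquivalence _≡_[mod q ]
    ≡[mod]-isEquivalence = record
      { refl = ≡[mod]-reflexive refl ; sym = ≡[mod]-sym ; trans = ≡[mod]-trans }

    ≡[mod]-setoid : Setoid _ _
    ≡[mod]-setoid = record { isEquivalence = ≡[mod]-isEquivalence }

    +-cong-≡[mod] : ∀ {x x′ y y′} → x ≡ x′ [mod q ] → y ≡ y′ [mod q ] → x + y ≡ x′ + y′ [mod q ]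
    +-cong-≡[mod] {x} {x′} {y} {y′} (mod-∣ q∣₁) (mod-∣ q∣₂) = by (lemma x x′ y y′) (∣m∣n⇒∣m+n q∣₁ q∣₂)
      where lemma : ∀ x x′ y y′ → (x - x′) + (y - y′) ≡ (x + y) - (x′ + y′)
            lemma = solve-∀

    +-congˡ-≡[mod] : ∀ x {y y′} → y ≡ y′ [mod q ] → x + y ≡ x + y′ [mod q ]
    +-congˡ-≡[mod] x = +-cong-≡[mod] (≡[mod]-reflexive {x} refl)

    *-congˡ-≡[mod] : ∀ c {x y} → x ≡ y [mod q ] → c * x ≡ c * y [mod q ]
    *-congˡ-≡[mod] c {x} {y} (mod-∣ q∣) = by (lemma c x y) (∣n⇒∣m*n c q∣)
      where lemma : ∀ c x y → c * (x - y) ≡ c * x - c * y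
            lemma = solve-∀

    +-cancelʳ-≡[mod] : ∀ {x x′} y → x + y ≡ x′ + y [mod q ] → x ≡ x′ [mod q ]
    +-cancelʳ-≡[mod] {x} {x′} y (mod-∣ q∣) = by (lemma x x′ y) q∣
      where lemma : ∀ x x′ y → (x + y) - (x′ + y) ≡ x - x′
            lemma = solve-∀

    ∑-cong-≡[mod] : ∀ {N} {f g : Fin N → ℤ} → (∀ t → f t ≡ g t [mod q ]) →
                    ∑[ t < N ] f t ≡ ∑[ t < N ] g t [mod q ]
    ∑-cong-≡[mod] {zero}  _   = ≡[mod]-reflexive refl
    ∑-cong-≡[mod] {suc N} f≡g = +-cong-≡[mod] (f≡g zero) (∑-cong-≡[mod] (f≡g ∘ suc))

    ≡0[mod]⇒∣ : ∀ {x} → x ≡ + 0 [mod q ] → q ∣ x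
    ≡0[mod]⇒∣ {x} (mod-∣ q∣) = subst (q ∣_) (ℤP.+-identityʳ x) q∣

    *-≡0[mod] : ∀ x → q * x ≡ + 0 [mod q ]
    *-≡0[mod] x = mod-∣ (subst (q ∣_) (sym (ℤP.+-identityʳ (q * x))) (divides x (ℤP.*-comm q x)))

  ∑-distrib-- : ∀ {n} (f g : Fin n → ℤ) → ∑[ i < n ] (f i - g i) ≡ ∑[ i < n ] f i - ∑[ i < n ] g i
  ∑-distrib-- {zero}  f g = refl
  ∑-distrib-- {suc n} f g =
    trans (cong (_+_ (f zero - g zero)) (∑-distrib-- (f ∘ suc) (g ∘ suc))) (lemma (f zero) (g zero) _ _)
    where lemma : ∀ a b c d → a - b + (c - d) ≡ a + c - (b + d)
          lemma = solve-∀

  sumℤ≡∑ : ∀ {n} (f : Fin n → ℤ) → sumℤ f ≡ ∑[ i < n ] f i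
  sumℤ≡∑ {zero}  f = refl
  sumℤ≡∑ {suc n} f = cong (_+_ (f zero)) (sumℤ≡∑ (λ i → f (suc i)))

  ∣-∑ : ∀ {q N} (f : Fin N → ℤ) → (∀ t → q ∣ f t) → q ∣ ∑[ t < N ] f t
  ∣-∑ {q} {zero}  f _   = divides (+ 0) (sym (ℤP.*-zeroˡ q))
  ∣-∑ {q} {suc N} f q∣f = ∣m∣n⇒∣m+n (q∣f zero) (∣-∑ (f ∘ suc) (q∣f ∘ suc))

  ∑-insertAt : ∀ {N} (c : Fin N → ℤ) t₀ c₀ (g : Fin (suc N) → ℤ) →
    ∑[ t < suc N ] (insertAt c t₀ c₀ t * g t) ≡ c₀ * g t₀ + ∑[ i < N ] (c i * g (punchIn t₀ i))
  ∑-insertAt c t₀ c₀ g = trans (sum-remove {i = t₀} (λ t → insertAt c t₀ c₀ t * g t))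
    (cong₂ _+_ (cong (_* g t₀) (insertAt-lookup c t₀ c₀))
               (sum-cong-≗ (λ i → cong (_* g (punchIn t₀ i)) (insertAt-punchIn c t₀ c₀ i))))

  basis : ∀ {n} → Fin n → Fin n → ℤ
  basis j i with i Fin.≟ j
  ... | yes _ = + 1
  ... | no  _ = + 0

  basis-diagonal : ∀ {n} (j : Fin n) → basis j j ≡ + 1
  basis-diagonal j with j Fin.≟ j
  ... | yes _   = refl
  ... | no  j≢j = ⊥-elim (j≢j refl)

  basis-offDiagonal : ∀ {n} {i j : Fin n} → i ≢ j → basis j i ≡ + 0
  basis-offDiagonal {i = i} {j} i≢j with i Fin.≟ j
  ... | yes i≡j = ⊥-elim (i≢j i≡j)
  ... | no  _   = refl

  basis-sym : ∀ {n} (i j : Fin n) → basis j i ≡ basis i j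
  basis-sym i j with i Fin.≟ j
  ... | yes refl = sym (basis-diagonal i)
  ... | no  i≢j  = sym (basis-offDiagonal (i≢j ∘ sym))

  ∑-basis : ∀ {n} (f : Fin n → ℤ) (j : Fin n) → ∑[ i < n ] (f i * basis j i) ≡ f j
  ∑-basis {suc n} f j = begin
    ∑[ i < suc n ] (f i * basis j i)
      ≡⟨ sum-remove {i = j} (λ i → f i * basis j i) ⟩
    f j * basis j j + ∑[ i < n ] (f (punchIn j i) * basis j (punchIn j i))
      ≡⟨ cong₂ (λ b s → f j * b + s) (basis-diagonal j) (sum-cong-≗ off-diagonal-vanishes) ⟩
    f j * + 1 + ∑[ i < n ] (+ 0)
      ≡⟨ cong₂ _+_ (ℤP.*-identityʳ (f j)) (sum-replicate-zero n) ⟩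
    f j + + 0
      ≡⟨ ℤP.+-identityʳ (f j) ⟩
    f j ∎
    where
    open ≡-Reasoning
    off-diagonal-vanishes : ∀ i → f (punchIn j i) * basis j (punchIn j i) ≡ + 0
    off-diagonal-vanishes i =
      trans (cong (f (punchIn j i) *_) (basis-offDiagonal (FinP.punchInᵢ≢i j i)))
            (ℤP.*-zeroʳ (f (punchIn j i)))

  ⟨_,_⟩ : ∀ {n} → (Fin n → ℤ) → (Fin n → ℤ) → ℤ
  ⟨_,_⟩ {n} y x = ∑[ v < n ] (y v * x v)

  ⟨⟩-*ʳ : ∀ {n} (y : Fin n → ℤ) c x → ⟨ y , (λ v → c * x v) ⟩ ≡ c * ⟨ y , x ⟩
  ⟨⟩-*ʳ y c x = trans (sum-cong-≗ (λ v → lemma (y v) c (x v))) (sym (*-distribˡ-sum c (λ v → y v * x v)))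
    where lemma : ∀ y c x → y * (c * x) ≡ c * (y * x)
          lemma = solve-∀

  ⟨⟩-+ʳ : ∀ {n} (y : Fin n → ℤ) x z → ⟨ y , (λ v → x v + z v) ⟩ ≡ ⟨ y , x ⟩ + ⟨ y , z ⟩
  ⟨⟩-+ʳ y x z = trans (sum-cong-≗ (λ v → ℤP.*-distribˡ-+ (y v) (x v) (z v)))
                      (∑-distrib-+ (λ v → y v * x v) (λ v → y v * z v))

  ⟨⟩-basisʳ : ∀ {n} (y : Fin n → ℤ) j → ⟨ y , basis j ⟩ ≡ y j
  ⟨⟩-basisʳ = ∑-basis

  -- Linear dependence modulo a prime

  prime-∣-* : ∀ {p} → Prime p → ∀ x y → + p ∣ x * y → (+ p ∣ x) ⊎ (+ p ∣ y)
  prime-∣-* p-prime x y p∣xy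
    with euclidsLemma ℤ.∣ x ∣ ℤ.∣ y ∣ p-prime (subst (_ ℕ∣.∣_) (ℤP.abs-* x y) (∣⇒∣ᵤ p∣xy))
  ... | inj₁ p∣x = inj₁ (∣ᵤ⇒∣ p∣x)
  ... | inj₂ p∣y = inj₂ (∣ᵤ⇒∣ p∣y)

  SupportedOn-tail : ∀ {n} {δ : Fin (suc n) → ℤ} {s Z} →
                     SupportedOn δ (s ∷ Z) → SupportedOn (δ ∘ suc) Z
  SupportedOn-tail δ-supp u u∉Z = δ-supp (suc u) (u∉Z ∘ drop-there)

  DependentMod : ℕ → ∀ {N n} → (Fin N → Fin n → ℤ) → Set
  DependentMod p {N} v =
    Σ (Fin N → ℤ) λ c → (∃[ t ] ¬ (+ p ∣ c t)) × (∀ u → + p ∣ ∑[ t < N ] (c t * v t u))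

  eliminate : ∀ {N n} → Fin (suc N) → (Fin (suc N) → Fin (suc n) → ℤ) → Fin N → Fin n → ℤ
  eliminate t₀ v i u = v t₀ zero * v (punchIn t₀ i) (suc u) - v (punchIn t₀ i) zero * v t₀ (suc u)

  eliminate-supported : ∀ {N n} {s} {Z : Subset n} t₀ (v : Fin (suc N) → Fin (suc n) → ℤ) →
    (∀ t → SupportedOn (v t) (s ∷ Z)) → ∀ i → SupportedOn (eliminate t₀ v i) Z
  eliminate-supported t₀ v v-supp i u u∉Z = begin
    eliminate t₀ v i u
      ≡⟨ cong₂ (λ x y → v t₀ zero * x - v (punchIn t₀ i) zero * y)
               (SupportedOn-tail (v-supp (punchIn t₀ i)) u u∉Z) (SupportedOn-tail (v-supp t₀) u u∉Z) ⟩
    v t₀ zero * + 0 - v (punchIn t₀ i) zero * + 0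
      ≡⟨ lemma (v t₀ zero) (v (punchIn t₀ i) zero) ⟩
    + 0 ∎
    where
    open ≡-Reasoning
    lemma : ∀ a b → a * + 0 - b * + 0 ≡ + 0
    lemma = solve-∀

  module _ {p : ℕ} (p-prime : Prime p) where

    DependentMod-dropColumn : ∀ {N n} (v : Fin N → Fin (suc n) → ℤ) → (∀ t → + p ∣ v t zero) →
                              DependentMod p (λ t u → v t (suc u)) → DependentMod p v
    DependentMod-dropColumn v p∣v₀ (c , nontrivial , p∣cv) = c , nontrivial , λ
      { zero    → ∣-∑ (λ t → c t * v t zero) (λ t → ∣n⇒∣m*n (c t) (p∣v₀ t))
      ; (suc u) → p∣cv u }

    DependentMod-pivot : ∀ {N n} (v : Fin (suc N) → Fin (suc n) → ℤ) t₀ → ¬ (+ p ∣ v t₀ zero) →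
                         DependentMod p (eliminate t₀ v) → DependentMod p v
    DependentMod-pivot {N} {n} v t₀ p∤α (c′ , (i₀ , p∤c′i₀) , p∣c′w) = c , (punchIn t₀ i₀ , p∤ci₀) , p∣cv
      where
      -- Row t₀ gets coefficient -S and every other row α times its coefficient in the
      -- eliminated system, which clears column zero and reproduces the other columns.
      open ≡-Reasoning
      α = v t₀ zero
      v′ : Fin N → Fin (suc n) → ℤ
      v′ i = v (punchIn t₀ i)
      S = ∑[ i < N ] (c′ i * v′ i zero)
      c : Fin (suc N) → ℤ
      c = insertAt (λ i → α * c′ i) t₀ (- S)

      expand : ∀ u → ∑[ t < suc N ] (c t * v t u) ≡ - S * v t₀ u + ∑[ i < N ] (α * c′ i * v′ i u)
      expand u = ∑-insertAt (λ i → α * c′ i) t₀ (- S) (λ t → v t u)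

      αS : ∑[ i < N ] (α * c′ i * v′ i zero) ≡ α * S
      αS = trans (sum-cong-≗ (λ i → ℤP.*-assoc α (c′ i) (v′ i zero)))
                 (sym (*-distribˡ-sum α (λ i → c′ i * v′ i zero)))

      zero-column : ∑[ t < suc N ] (c t * v t zero) ≡ + 0
      zero-column = begin
        ∑[ t < suc N ] (c t * v t zero)  ≡⟨ expand zero ⟩
        - S * α + ∑[ i < N ] (α * c′ i * v′ i zero) ≡⟨ cong (_+_ (- S * α)) αS ⟩
        - S * α + α * S  ≡⟨ cancel S α ⟩
        + 0 ∎
        where cancel : ∀ s a → - s * a + a * s ≡ + 0
              cancel = solve-∀

      other-column : ∀ u → ∑[ i < N ] (c′ i * eliminate t₀ v i u) ≡ ∑[ t < suc N ] (c t * v t (suc u))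
      other-column u = begin
        ∑[ i < N ] (c′ i * eliminate t₀ v i u)
          ≡⟨ sum-cong-≗ (λ i → distribute (c′ i) α (v′ i (suc u)) (v′ i zero) (v t₀ (suc u))) ⟩
        ∑[ i < N ] (α * c′ i * v′ i (suc u) - c′ i * v′ i zero * v t₀ (suc u))
          ≡⟨ ∑-distrib-- (λ i → α * c′ i * v′ i (suc u)) (λ i → c′ i * v′ i zero * v t₀ (suc u)) ⟩
        ∑[ i < N ] (α * c′ i * v′ i (suc u)) - ∑[ i < N ] (c′ i * v′ i zero * v t₀ (suc u))
          ≡⟨ cong (_-_ (∑[ i < N ] (α * c′ i * v′ i (suc u))))
                  (sym (*-distribʳ-sum (v t₀ (suc u)) (λ i → c′ i * v′ i zero))) ⟩
        ∑[ i < N ] (α * c′ i * v′ i (suc u)) - S * v t₀ (suc u)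
          ≡⟨ swap _ S (v t₀ (suc u)) ⟩
        - S * v t₀ (suc u) + ∑[ i < N ] (α * c′ i * v′ i (suc u))
          ≡⟨ sym (expand (suc u)) ⟩
        ∑[ t < suc N ] (c t * v t (suc u)) ∎
        where
        distribute : ∀ c a x y z → c * (a * x - y * z) ≡ a * c * x - c * y * z
        distribute = solve-∀
        swap : ∀ t s x → t - s * x ≡ - s * x + t
        swap = solve-∀

      p∤ci₀ : ¬ (+ p ∣ c (punchIn t₀ i₀))
      p∤ci₀ p∣ci₀ = [ p∤α , p∤c′i₀ ]
        (prime-∣-* p-prime α (c′ i₀) (subst (+ p ∣_) (insertAt-punchIn (λ i → α * c′ i) t₀ (- S) i₀) p∣ci₀))

      p∣cv : ∀ u → + p ∣ ∑[ t < suc N ] (c t * v t u)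
      p∣cv zero    = subst (+ p ∣_) (sym zero-column) (∣-∑ {N = zero} (λ ()) (λ ()))
      p∣cv (suc u) = subst (+ p ∣_) (other-column u) (p∣c′w u)

    dependentMod : ∀ {N n} (Z : Subset n) → ∣ Z ∣ ℕ.< N → (v : Fin N → Fin n → ℤ) →
                   (∀ t → SupportedOn (v t) Z) → DependentMod p v
    dependentMod {suc N} [] _ v _ = (λ _ → + 1) , (zero , p∤1) , λ ()
      where p∤1 : ¬ (+ p ∣ + 1)
            p∤1 p∣1 = ¬prime[1] (subst Prime (ℕ∣.∣1⇒≡1 (∣⇒∣ᵤ p∣1)) p-prime)
    dependentMod (outside ∷ Z) |Z|<N v v-supp =
      DependentMod-dropColumn v
        (λ t → subst (+ p ∣_) (sym (v-supp t zero (λ ()))) (∣-∑ {N = zero} (λ ()) (λ ())))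
        (dependentMod Z |Z|<N (λ t → v t ∘ suc) (λ t → SupportedOn-tail (v-supp t)))
    dependentMod (inside ∷ Z) (s≤s |Z|<N′) v v-supp with FinP.all? (λ t → + p ∣? v t zero)
    ... | yes p∣v₀ = DependentMod-dropColumn v p∣v₀ (dependentMod Z (ℕP.m<n⇒m<1+n |Z|<N′)
                       (λ t → v t ∘ suc) (λ t → SupportedOn-tail (v-supp t)))
    ... | no ¬p∣v₀ with FinP.¬∀⟶∃¬ _ (λ t → + p ∣ v t zero) (λ t → + p ∣? v t zero) ¬p∣v₀
    ...   | t₀ , p∤v₀ = DependentMod-pivot v t₀ p∤v₀
                          (dependentMod Z |Z|<N′ (eliminate t₀ v) (eliminate-supported t₀ v v-supp))

  -- The operator L(G,d), its image and its torsion

  module _ {n} (G : Graph n) (d : Fin n → ℕ) where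

    L-expand : ∀ x v → L G d x v ≡ + d v * x v - ∑[ u < n ] (+ adj G v u * x u)
    L-expand x v = cong (_-_ (+ d v * x v)) (sumℤ≡∑ (λ u → + adj G v u * x u))

    L-+ : ∀ x y v → L G d (λ u → x u + y u) v ≡ L G d x v + L G d y v
    L-+ x y v = begin
      L G d (λ u → x u + y u) v
        ≡⟨ L-expand _ v ⟩
      + d v * (x v + y v) - ∑[ u < n ] (+ adj G v u * (x u + y u))
        ≡⟨ cong (_-_ (+ d v * (x v + y v)))
             (trans (sum-cong-≗ (λ u → ℤP.*-distribˡ-+ (+ adj G v u) (x u) (y u)))
                    (∑-distrib-+ (λ u → + adj G v u * x u) (λ u → + adj G v u * y u))) ⟩
      + d v * (x v + y v) - (∑[ u < n ] (+ adj G v u * x u) + ∑[ u < n ] (+ adj G v u * y u))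
        ≡⟨ lemma (+ d v) (x v) (y v) _ _ ⟩
      (+ d v * x v - ∑[ u < n ] (+ adj G v u * x u)) + (+ d v * y v - ∑[ u < n ] (+ adj G v u * y u))
        ≡⟨ sym (cong₂ _+_ (L-expand x v) (L-expand y v)) ⟩
      L G d x v + L G d y v ∎
      where
      open ≡-Reasoning
      lemma : ∀ D a b s t → D * (a + b) - (s + t) ≡ (D * a - s) + (D * b - t)
      lemma = solve-∀

    L-* : ∀ c x v → L G d (λ u → c * x u) v ≡ c * L G d x v
    L-* c x v = begin
      L G d (λ u → c * x u) v
        ≡⟨ L-expand _ v ⟩
      + d v * (c * x v) - ∑[ u < n ] (+ adj G v u * (c * x u))
        ≡⟨ cong (_-_ (+ d v * (c * x v)))
             (trans (sum-cong-≗ (λ u → commute (+ adj G v u) c (x u)))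
                    (sym (*-distribˡ-sum c (λ u → + adj G v u * x u)))) ⟩
      + d v * (c * x v) - c * ∑[ u < n ] (+ adj G v u * x u)
        ≡⟨ lemma (+ d v) c (x v) _ ⟩
      c * (+ d v * x v - ∑[ u < n ] (+ adj G v u * x u))
        ≡⟨ cong (c *_) (sym (L-expand x v)) ⟩
      c * L G d x v ∎
      where
      open ≡-Reasoning
      commute : ∀ A c x → A * (c * x) ≡ c * (A * x)
      commute = solve-∀
      lemma : ∀ D c a s → D * (c * a) - c * s ≡ c * (D * a - s)
      lemma = solve-∀

    ⟨⟩-L : ∀ y x → ⟨ y , L G d x ⟩ ≡
      ∑[ v < n ] (+ d v * (y v * x v)) - ∑[ v < n ] ∑[ u < n ] (+ adj G v u * (y v * x u))
    ⟨⟩-L y x = trans (sum-cong-≗ expand)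
      (∑-distrib-- (λ v → + d v * (y v * x v)) (λ v → ∑[ u < n ] (+ adj G v u * (y v * x u))))
      where
      open ≡-Reasoning
      lemma : ∀ y D x s → y * (D * x - s) ≡ D * (y * x) - y * s
      lemma = solve-∀
      commute : ∀ y A x → y * (A * x) ≡ A * (y * x)
      commute = solve-∀
      expand : ∀ v → y v * L G d x v ≡ + d v * (y v * x v) - ∑[ u < n ] (+ adj G v u * (y v * x u))
      expand v = begin
        y v * L G d x v
          ≡⟨ cong (y v *_) (L-expand x v) ⟩
        y v * (+ d v * x v - ∑[ u < n ] (+ adj G v u * x u))
          ≡⟨ lemma (y v) (+ d v) (x v) _ ⟩
        + d v * (y v * x v) - y v * ∑[ u < n ] (+ adj G v u * x u)
          ≡⟨ cong (_-_ (+ d v * (y v * x v)))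
               (trans (*-distribˡ-sum (y v) (λ u → + adj G v u * x u))
                      (sum-cong-≗ (λ u → commute (y v) (+ adj G v u) (x u)))) ⟩
        + d v * (y v * x v) - ∑[ u < n ] (+ adj G v u * (y v * x u)) ∎

    L-selfAdjoint : ∀ y x → ⟨ y , L G d x ⟩ ≡ ⟨ x , L G d y ⟩
    L-selfAdjoint y x = begin
      ⟨ y , L G d x ⟩
        ≡⟨ ⟨⟩-L y x ⟩
      ∑[ v < n ] (+ d v * (y v * x v)) - ∑[ v < n ] ∑[ u < n ] (+ adj G v u * (y v * x u))
        ≡⟨ cong₂ _-_ (sum-cong-≗ (λ v → cong (+ d v *_) (ℤP.*-comm (y v) (x v))))
                     (trans (∑-comm (λ v u → + adj G v u * (y v * x u)))
                            (sum-cong-≗ (λ u → sum-cong-≗ (λ v →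
                              cong₂ _*_ (cong +_ (symmetric G v u)) (ℤP.*-comm (y v) (x u)))))) ⟩
      ∑[ v < n ] (+ d v * (x v * y v)) - ∑[ v < n ] ∑[ u < n ] (+ adj G v u * (x v * y u))
        ≡⟨ sym (⟨⟩-L x y) ⟩
      ⟨ x , L G d y ⟩ ∎
      where open ≡-Reasoning

    InIm-resp-≗ : ∀ {δ δ′} → δ ≗ δ′ → InIm G d δ → InIm G d δ′
    InIm-resp-≗ δ≗δ′ (x , δ≡Lx) = x , λ v → trans (sym (δ≗δ′ v)) (δ≡Lx v)

    InIm-+ : ∀ {δ δ′} → InIm G d δ → InIm G d δ′ → InIm G d (λ v → δ v + δ′ v)
    InIm-+ (x , δ≡Lx) (y , δ′≡Ly) =
      (λ u → x u + y u) , λ v → trans (cong₂ _+_ (δ≡Lx v) (δ′≡Ly v)) (sym (L-+ x y v))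

    InIm-* : ∀ c {δ} → InIm G d δ → InIm G d (λ v → c * δ v)
    InIm-* c (x , δ≡Lx) = (λ u → c * x u) , λ v → trans (cong (c *_) (δ≡Lx v)) (sym (L-* c x v))

    InIm-0 : InIm G d (λ _ → + 0)
    InIm-0 = InIm-resp-≗ (λ v → ℤP.*-zeroˡ (L G d (λ _ → + 0) v)) (InIm-* (+ 0) ((λ _ → + 0) , λ v → refl))

    InIm-∑ : ∀ {N} (δ : Fin N → Fin n → ℤ) → (∀ t → InIm G d (δ t)) →
             InIm G d (λ v → ∑[ t < N ] δ t v)
    InIm-∑ {zero}  δ _     = InIm-0
    InIm-∑ {suc N} δ δ-InIm = InIm-+ (δ-InIm zero) (InIm-∑ (δ ∘ suc) (δ-InIm ∘ suc))

    IsTorsion : (Fin n → ℤ) → Set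
    IsTorsion δ = ∃[ s ] InIm G d (λ v → + suc s * δ v)

    InIm⇒IsTorsion : ∀ {δ} → InIm G d δ → IsTorsion δ
    InIm⇒IsTorsion {δ} δ-InIm = 0 , InIm-resp-≗ (λ v → sym (ℤP.*-identityˡ (δ v))) δ-InIm

    IsTorsion-resp-≗ : ∀ {δ δ′} → δ ≗ δ′ → IsTorsion δ → IsTorsion δ′
    IsTorsion-resp-≗ δ≗δ′ (s , sδ-InIm) = s , InIm-resp-≗ (λ v → cong (+ suc s *_) (δ≗δ′ v)) sδ-InIm

    IsTorsion-* : ∀ c {δ} → IsTorsion δ → IsTorsion (λ v → c * δ v)
    IsTorsion-* c {δ} (s , sδ-InIm) =
      s , InIm-resp-≗ (λ v → commute c (+ suc s) (δ v)) (InIm-* c sδ-InIm)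
      where commute : ∀ c s x → c * (s * x) ≡ s * (c * x)
            commute = solve-∀

    IsTorsion-+ : ∀ {δ δ′} → IsTorsion δ → IsTorsion δ′ → IsTorsion (λ v → δ v + δ′ v)
    IsTorsion-+ {δ} {δ′} (s , sδ-InIm) (t , tδ′-InIm) = t ℕ.+ s ℕ.* suc t ,
      InIm-resp-≗ (λ v → lemma (+ suc s) (+ suc t) (δ v) (δ′ v))
                  (InIm-+ (InIm-* (+ suc t) sδ-InIm) (InIm-* (+ suc s) tδ′-InIm))
      where lemma : ∀ s t x y → t * (s * x) + s * (t * y) ≡ (s * t) * (x + y)
            lemma = solve-∀

    IsTorsion-- : ∀ {δ δ′} → IsTorsion δ → IsTorsion δ′ → IsTorsion (λ v → δ v - δ′ v)
    IsTorsion-- {δ} {δ′} δ-torsion δ′-torsion = IsTorsion-resp-≗ {λ v → δ v + - + 1 * δ′ v}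
      (λ v → lemma (δ v) (δ′ v)) (IsTorsion-+ δ-torsion (IsTorsion-* (- + 1) δ′-torsion))
      where lemma : ∀ x y → x + - + 1 * y ≡ x - y
            lemma = solve-∀

    IsTorsion-∑ : ∀ {N} (δ : Fin N → Fin n → ℤ) → (∀ t → IsTorsion (δ t)) →
                  IsTorsion (λ v → ∑[ t < N ] δ t v)
    IsTorsion-∑ {zero}  δ _         = InIm⇒IsTorsion InIm-0
    IsTorsion-∑ {suc N} δ δ-torsion = IsTorsion-+ (δ-torsion zero) (IsTorsion-∑ (δ ∘ suc) (δ-torsion ∘ suc))

    IsTorsion-divide : ∀ m {δ} → IsTorsion (λ v → + suc m * δ v) → IsTorsion δ
    IsTorsion-divide m {δ} (s , smδ-InIm) =
      m ℕ.+ s ℕ.* suc m , InIm-resp-≗ (λ v → sym (ℤP.*-assoc (+ suc s) (+ suc m) (δ v))) smδ-InIm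

  module _ {n} {G : Graph n} {d r : Fin n → ℕ} (arithmetical : IsArithmetical G d r) where

    private
      rℤ : Fin n → ℤ
      rℤ v = + r v

    InIm⇒⟨r,⟩≡0 : ∀ {δ} → InIm G d δ → ⟨ rℤ , δ ⟩ ≡ + 0
    InIm⇒⟨r,⟩≡0 (x , δ≡Lx) = begin
      ⟨ rℤ , _ ⟩          ≡⟨ sum-cong-≗ (λ v → cong (+ r v *_) (δ≡Lx v)) ⟩
      ⟨ rℤ , L G d x ⟩    ≡⟨ L-selfAdjoint G d rℤ x ⟩
      ⟨ x , L G d rℤ ⟩    ≡⟨ sum-cong-≗ (λ v → cong (x v *_) (IsArithmetical.kernel arithmetical v)) ⟩
      ∑[ v < n ] (x v * + 0) ≡⟨ sum-cong-≗ (λ v → ℤP.*-zeroʳ (x v)) ⟩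
      ∑[ v < n ] (+ 0)    ≡⟨ sum-replicate-zero n ⟩
      + 0 ∎
      where open ≡-Reasoning

    IsTorsion⇒⟨r,⟩≡0 : ∀ {δ} → IsTorsion G d δ → ⟨ rℤ , δ ⟩ ≡ + 0
    IsTorsion⇒⟨r,⟩≡0 {δ} (s , sδ-InIm) = ℤP.*-cancelˡ-≡ (+ suc s) ⟨ rℤ , δ ⟩ (+ 0) (begin
      + suc s * ⟨ rℤ , δ ⟩               ≡⟨ sym (⟨⟩-*ʳ rℤ (+ suc s) δ) ⟩
      ⟨ rℤ , (λ v → + suc s * δ v) ⟩     ≡⟨ InIm⇒⟨r,⟩≡0 sδ-InIm ⟩
      + 0                                ≡⟨ sym (ℤP.*-zeroʳ (+ suc s)) ⟩
      + suc s * + 0 ∎)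
      where open ≡-Reasoning

  module _ {n} (G : Graph n) (d : Fin n → ℕ) {p : ℕ} (p-prime : Prime p) (Z : Subset n)
           (reduce : ∀ (δ : Fin n → ℤ) → ∃[ δ′ ] (SupportedOn δ′ Z × InIm G d (λ v → δ v - δ′ v))) where

    dependentModIm : ∀ {N} → ∣ Z ∣ ℕ.< N → (g : Fin N → Fin n → ℤ) →
      Σ (Fin N → ℤ) λ c → Σ (Fin n → ℤ) λ w →
        (∃[ t ] ¬ (+ p ∣ c t)) × InIm G d (λ u → ∑[ t < N ] (c t * g t u) - + p * w u)
    dependentModIm {N} |Z|<N g = c , w , nontrivial , InIm-resp-≗ G d combine
        (InIm-∑ G d (λ t u → c t * (g t u - s t u)) (λ t → InIm-* G d (c t) (proj₂ (proj₂ (reduce (g t))))))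
      where
      s : Fin N → Fin n → ℤ
      s t = proj₁ (reduce (g t))
      dependence = dependentMod p-prime Z |Z|<N s (λ t → proj₁ (proj₂ (reduce (g t))))
      c = proj₁ dependence
      nontrivial = proj₁ (proj₂ dependence)
      p∣cs = proj₂ (proj₂ dependence)
      w : Fin n → ℤ
      w u = _∣_.quotient (p∣cs u)
      combine : ∀ u → ∑[ t < N ] (c t * (g t u - s t u)) ≡ ∑[ t < N ] (c t * g t u) - + p * w u
      combine u = begin
        ∑[ t < N ] (c t * (g t u - s t u))
          ≡⟨ trans (sum-cong-≗ (λ t → distribute (c t) (g t u) (s t u)))
                   (∑-distrib-- (λ t → c t * g t u) (λ t → c t * s t u)) ⟩
        ∑[ t < N ] (c t * g t u) - ∑[ t < N ] (c t * s t u)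
          ≡⟨ cong (_-_ (∑[ t < N ] (c t * g t u))) (trans (_∣_.equality (p∣cs u)) (ℤP.*-comm (w u) (+ p))) ⟩
        ∑[ t < N ] (c t * g t u) - + p * w u ∎
        where
        open ≡-Reasoning
        distribute : ∀ c x y → c * (x - y) ≡ c * x - c * y
        distribute = solve-∀

  -- The critical group as a ℤ-module, and the given isomorphism reduced modulo p

  module CritModule {n} (G : Graph n) (d : Fin n → ℕ) where

    infixl 6 _+ᶜ_
    infixl 7 _·ᶜ_

    0ᶜ : Crit G d
    0ᶜ = (λ _ → + 0) , InIm⇒IsTorsion G d (InIm-0 G d)

    _+ᶜ_ : Crit G d → Crit G d → Crit G d
    (δ , δ-torsion) +ᶜ (δ′ , δ′-torsion) = (λ v → δ v + δ′ v) , IsTorsion-+ G d δ-torsion δ′-torsion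

    _·ᶜ_ : ℤ → Crit G d → Crit G d
    c ·ᶜ (δ , δ-torsion) = (λ v → c * δ v) , IsTorsion-* G d c δ-torsion

    ∑ᶜ : ∀ {N} → (Fin N → ℤ) → (Fin N → Crit G d) → Crit G d
    ∑ᶜ {N} c x = (λ v → ∑[ t < N ] (c t * proj₁ (x t) v)) ,
      IsTorsion-∑ G d (λ t v → c t * proj₁ (x t) v) (λ t → IsTorsion-* G d (c t) (proj₂ (x t)))

  module _ {n k} {G : Graph n} {d : Fin n → ℕ} {a : Fin k → ℕ}
           (iso : CritIso G d a) (p : ℕ) (p∣a : ∀ i → p ℕ∣.∣ a i) where

    open CritIso iso using (f; resp; hom; surj)
    open CritModule G d

    private
      ≈[a]⇒≡[mod] : ∀ {x y} → x ≈[ a ] y → ∀ i → x i ≡ y i [mod + p ]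
      ≈[a]⇒≡[mod] {x} {y} x≈y i =
        mod-∣ (∣-trans (∣ᵤ⇒∣ {+ p} {+ a i} (p∣a i)) (∣ᵤ⇒∣ {+ a i} {x i - y i} (x≈y i)))

    open import Relation.Binary.Reasoning.Setoid (≡[mod]-setoid {+ p})

    f-cong : ∀ x y → proj₁ x ≗ proj₁ y → ∀ i → f x i ≡ f y i [mod + p ]
    f-cong x y x≗y = ≈[a]⇒≡[mod] {f x} {f y} (resp x y (InIm-resp-≗ G d
      (λ v → sym (trans (cong (_-_ (proj₁ x v)) (sym (x≗y v))) (ℤP.+-inverseʳ (proj₁ x v)))) (InIm-0 G d)))

    f-+ : ∀ x y i → f (x +ᶜ y) i ≡ f x i + f y i [mod + p ]
    f-+ x y = ≈[a]⇒≡[mod] {f (x +ᶜ y)} (hom x y (x +ᶜ y) (λ v → refl))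

    f-0 : ∀ i → f 0ᶜ i ≡ + 0 [mod + p ]
    f-0 i = +-cancelʳ-≡[mod] (f 0ᶜ i) (begin
      f 0ᶜ i + f 0ᶜ i  ≈⟨ ≡[mod]-sym (≈[a]⇒≡[mod] {f 0ᶜ} (hom 0ᶜ 0ᶜ 0ᶜ (λ v → refl)) i) ⟩
      f 0ᶜ i           ≡⟨ sym (ℤP.+-identityˡ (f 0ᶜ i)) ⟩
      + 0 + f 0ᶜ i     ∎)

    f-·ℕ : ∀ m x i → f (+ m ·ᶜ x) i ≡ + m * f x i [mod + p ]
    f-·ℕ zero x i = begin
      f (+ 0 ·ᶜ x) i  ≈⟨ f-cong (+ 0 ·ᶜ x) 0ᶜ (λ v → ℤP.*-zeroˡ (proj₁ x v)) i ⟩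
      f 0ᶜ i          ≈⟨ f-0 i ⟩
      + 0             ≡⟨ sym (ℤP.*-zeroˡ (f x i)) ⟩
      + 0 * f x i     ∎
    f-·ℕ (suc m) x i = begin
      f (+ suc m ·ᶜ x) i
        ≈⟨ f-cong (+ suc m ·ᶜ x) (x +ᶜ (+ m ·ᶜ x)) (λ v → unfold (+ m) (proj₁ x v)) i ⟩
      f (x +ᶜ (+ m ·ᶜ x)) i      ≈⟨ f-+ x (+ m ·ᶜ x) i ⟩
      f x i + f (+ m ·ᶜ x) i     ≈⟨ +-congˡ-≡[mod] (f x i) (f-·ℕ m x i) ⟩
      f x i + + m * f x i        ≡⟨ sym (unfold (+ m) (f x i)) ⟩
      + suc m * f x i            ∎
      where unfold : ∀ m x → (+ 1 + m) * x ≡ x + m * x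
            unfold = solve-∀

    f-· : ∀ c x i → f (c ·ᶜ x) i ≡ c * f x i [mod + p ]
    f-· (+ m)    x i = f-·ℕ m x i
    f-· -[1+ m ] x i = +-cancelʳ-≡[mod] (f (+ suc m ·ᶜ x) i) (begin
      f (-[1+ m ] ·ᶜ x) i + f (+ suc m ·ᶜ x) i  ≈⟨ ≡[mod]-sym (f-+ (-[1+ m ] ·ᶜ x) (+ suc m ·ᶜ x) i) ⟩
      f ((-[1+ m ] ·ᶜ x) +ᶜ (+ suc m ·ᶜ x)) i  ≈⟨ f-cong _ 0ᶜ (λ v → cancel (+ suc m) (proj₁ x v)) i ⟩
      f 0ᶜ i                                   ≈⟨ f-0 i ⟩
      + 0                                      ≡⟨ sym (cancel (+ suc m) (f x i)) ⟩
      -[1+ m ] * f x i + + suc m * f x i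
        ≈⟨ +-congˡ-≡[mod] (-[1+ m ] * f x i) (≡[mod]-sym (f-·ℕ (suc m) x i)) ⟩
      -[1+ m ] * f x i + f (+ suc m ·ᶜ x) i    ∎)
      where cancel : ∀ s x → (- s) * x + s * x ≡ + 0
            cancel = solve-∀

    f-∑ : ∀ {N} (c : Fin N → ℤ) x i → f (∑ᶜ c x) i ≡ ∑[ t < N ] (c t * f (x t) i) [mod + p ]
    f-∑ {zero}  c x i = ≡[mod]-trans (f-cong (∑ᶜ c x) 0ᶜ (λ v → refl) i) (f-0 i)
    f-∑ {suc N} c x i = begin
      f (∑ᶜ c x) i
        ≈⟨ f-cong (∑ᶜ c x) (c zero ·ᶜ x zero +ᶜ ∑ᶜ (c ∘ suc) (x ∘ suc)) (λ v → refl) i ⟩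
      f (c zero ·ᶜ x zero +ᶜ ∑ᶜ (c ∘ suc) (x ∘ suc)) i
        ≈⟨ f-+ (c zero ·ᶜ x zero) (∑ᶜ (c ∘ suc) (x ∘ suc)) i ⟩
      f (c zero ·ᶜ x zero) i + f (∑ᶜ (c ∘ suc) (x ∘ suc)) i
        ≈⟨ +-cong-≡[mod] (f-· (c zero) (x zero) i) (f-∑ (c ∘ suc) (x ∘ suc) i) ⟩
      c zero * f (x zero) i + ∑[ t < N ] (c (suc t) * f (x (suc t)) i) ∎

    f-divisible : .{{_ : NonZero p}} → ∀ y w → InIm G d (λ v → proj₁ y v - + p * w v) →
                  ∀ i → f y i ≡ + 0 [mod + p ]
    f-divisible y w y-pw∈Im i = begin
      f y i             ≈⟨ ≈[a]⇒≡[mod] {f y} (resp y (+ p ·ᶜ wᶜ) y-pw∈Im) i ⟩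
      f (+ p ·ᶜ wᶜ) i   ≈⟨ f-· (+ p) wᶜ i ⟩
      + p * f wᶜ i      ≈⟨ *-≡0[mod] (f wᶜ i) ⟩
      + 0               ∎
      where
      lemma : ∀ y P w → y - (y - P * w) ≡ P * w
      lemma = solve-∀
      pw-torsion : IsTorsion G d (λ v → + suc (ℕ.pred p) * w v)
      pw-torsion = IsTorsion-resp-≗ G d {λ v → proj₁ y v - (proj₁ y v - + p * w v)}
        (λ v → trans (lemma (proj₁ y v) (+ p) (w v)) (cong (λ m → + m * w v) (sym (ℕP.suc-pred p))))
        (IsTorsion-- G d (proj₂ y) (InIm⇒IsTorsion G d y-pw∈Im))
      wᶜ : Crit G d
      wᶜ = w , IsTorsion-divide G d (ℕ.pred p) pw-torsion

    generator : Fin k → Crit G d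
    generator i = proj₁ (surj (basis i))

    f-∑-generator : ∀ c j → f (∑ᶜ c generator) j ≡ c j [mod + p ]
    f-∑-generator c j = begin
      f (∑ᶜ c generator) j                  ≈⟨ f-∑ c generator j ⟩
      ∑[ t < k ] (c t * f (generator t) j)
        ≈⟨ ∑-cong-≡[mod] (λ t → *-congˡ-≡[mod] (c t)
             (≈[a]⇒≡[mod] {f (generator t)} {basis t} (proj₂ (surj (basis t))) j)) ⟩
      ∑[ t < k ] (c t * basis t j)
        ≡⟨ trans (sum-cong-≗ (λ t → cong (c t *_) (sym (basis-sym t j)))) (∑-basis c j) ⟩
      c j                                   ∎

  -- k + 1 independent classes modulo p

  module _ {n k} {G : Graph n} {d r : Fin n → ℕ} {a : Fin k → ℕ}
           (arithmetical : IsArithmetical G d r) (iso : CritIso G d a)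
           {p : ℕ} (p-prime : Prime p) (p∣a : ∀ i → p ℕ∣.∣ a i) where

    open CritModule G d
    open CritIso iso using (f)

    private
      instance
        p≢0 : NonZero p
        p≢0 = prime⇒nonZero p-prime

    ∃r-indivisible : ∃[ v ] ¬ (+ p ∣ + r v)
    ∃r-indivisible = FinP.¬∀⟶∃¬ n (λ v → + p ∣ + r v) (λ v → + p ∣? + r v)
      (λ p∣r → ¬prime[1]
        (subst Prime (IsArithmetical.r-prim arithmetical p (λ v → ∣⇒∣ᵤ (p∣r v))) p-prime))

    module _ (v₀ : Fin n) (p∤rv₀ : ¬ (+ p ∣ + r v₀)) where

      independentFamily : Fin (suc k) → Fin n → ℤ
      independentFamily zero    = basis v₀
      independentFamily (suc i) = proj₁ (generator iso p p∣a i)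

      module _ (c : Fin (suc k) → ℤ) (w : Fin n → ℤ)
               (combination∈Im : InIm G d (λ u → ∑[ t < suc k ] (c t * independentFamily t u) - + p * w u))
               where

        private
          T : Crit G d
          T = ∑ᶜ (c ∘ suc) (generator iso p p∣a)

        independentModIm-head : + p ∣ c zero
        independentModIm-head = [ id , ⊥-elim ∘ p∤rv₀ ]
          (prime-∣-* p-prime (c zero) (+ r v₀) (divides ⟨ rℤ , w ⟩ c₀rv₀≡⟨r,w⟩p))
          where
          rℤ : Fin n → ℤ
          rℤ v = + r v

          δ : Fin n → ℤ
          δ u = c zero * basis v₀ u + - + p * w u

          δ-torsion : IsTorsion G d δ
          δ-torsion = IsTorsion-resp-≗ G d
            {λ u → (c zero * basis v₀ u + proj₁ T u - + p * w u) - proj₁ T u}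
            (λ u → lemma (c zero) (basis v₀ u) (proj₁ T u) (+ p) (w u))
            (IsTorsion-- G d (InIm⇒IsTorsion G d combination∈Im) (proj₂ T))
            where lemma : ∀ c e t P w → (c * e + t - P * w) - t ≡ c * e + - P * w
                  lemma = solve-∀

          ⟨r,δ⟩ : ⟨ rℤ , δ ⟩ ≡ c zero * + r v₀ + - + p * ⟨ rℤ , w ⟩
          ⟨r,δ⟩ = trans (⟨⟩-+ʳ rℤ (λ u → c zero * basis v₀ u) (λ u → - + p * w u))
            (cong₂ _+_ (trans (⟨⟩-*ʳ rℤ (c zero) (basis v₀)) (cong (c zero *_) (⟨⟩-basisʳ rℤ v₀)))
                       (⟨⟩-*ʳ rℤ (- + p) w))

          c₀rv₀≡⟨r,w⟩p : c zero * + r v₀ ≡ ⟨ rℤ , w ⟩ * + p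
          c₀rv₀≡⟨r,w⟩p = trans (lemma (c zero * + r v₀) (+ p) R)
            (trans (cong (_+ R * + p) (trans (sym ⟨r,δ⟩) (IsTorsion⇒⟨r,⟩≡0 arithmetical δ-torsion)))
                   (ℤP.+-identityˡ (R * + p)))
            where R = ⟨ rℤ , w ⟩
                  lemma : ∀ x P R → x ≡ (x + - P * R) + R * P
                  lemma = solve-∀

        independentModIm-tail : + p ∣ c zero → ∀ i → + p ∣ c (suc i)
        independentModIm-tail p∣c₀ i = ≡0[mod]⇒∣ (begin
          c (suc i)  ≈⟨ ≡[mod]-sym (f-∑-generator iso p p∣a (c ∘ suc) i) ⟩
          f T i      ≈⟨ f-divisible iso p p∣a T w′ T-pw′∈Im i ⟩
          + 0        ∎)
          where
          open import Relation.Binary.Reasoning.Setoid (≡[mod]-setoid {+ p})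
          w′ : Fin n → ℤ
          w′ u = w u - _∣_.quotient p∣c₀ * basis v₀ u
          T-pw′∈Im : InIm G d (λ u → proj₁ T u - + p * w′ u)
          T-pw′∈Im = InIm-resp-≗ G d
            (λ u → trans (cong (λ c₀ → c₀ * basis v₀ u + proj₁ T u - + p * w u) (_∣_.equality p∣c₀))
                         (lemma (_∣_.quotient p∣c₀) (+ p) (basis v₀ u) (proj₁ T u) (w u)))
            combination∈Im
            where lemma : ∀ q P e t w → q * P * e + t - P * w ≡ t - P * (w - q * e)
                  lemma = solve-∀

      independentModIm : ∀ (c : Fin (suc k) → ℤ) (w : Fin n → ℤ) →
                         InIm G d (λ u → ∑[ t < suc k ] (c t * independentFamily t u) - + p * w u) →
                         ∀ t → + p ∣ c t
      independentModIm c w combination∈Im zero    = independentModIm-head c w combination∈Im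
      independentModIm c w combination∈Im (suc i) =
        independentModIm-tail c w combination∈Im (independentModIm-head c w combination∈Im) i

    rank-bound : (Z : Subset n) →
                 (∀ (δ : Fin n → ℤ) → ∃[ δ′ ] (SupportedOn δ′ Z × InIm G d (λ v → δ v - δ′ v))) →
                 suc k ≤ ∣ Z ∣
    rank-bound Z reduce = ℕP.≮⇒≥ λ |Z|<1+k →
      let v₀ , p∤rv₀ = ∃r-indivisible
          c , w , (t , p∤ct) , combination∈Im =
            dependentModIm G d p-prime Z reduce |Z|<1+k (independentFamily v₀ p∤rv₀)
      in p∤ct (independentModIm v₀ p∤rv₀ c w combination∈Im t)

  record CommonPrimeFactor {k} (a : Fin k → ℕ) : Set where
    field
      p       : ℕ
      p-prime : Prime p
      p∣a     : ∀ i → p ℕ∣.∣ a i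

  primeFactor : ∀ {m} → 1 ℕ.< m → ∃[ p ] Prime p × p ℕ∣.∣ m
  primeFactor {suc m} 1<m with factorise (suc m)
  ... | record { factors = [] ; isFactorisation = 1+m≡1 } = ⊥-elim (ℕP.<⇒≢ 1<m (sym 1+m≡1))
  ... | record { factors = q ∷ qs ; isFactorisation = 1+m≡qΠ ; factorsPrime = q-prime ∷ _ } =
    q , q-prime , subst (q ℕ∣.∣_) (sym 1+m≡qΠ) (ℕ∣.m∣m*n _)

  commonPrimeFactor : ∀ {k} {a : Fin k → ℕ} → IsInvariantFactors a → CommonPrimeFactor a
  commonPrimeFactor {zero}  _ = record { p = 2 ; p-prime = prime[2] ; p∣a = λ () }
  commonPrimeFactor {suc k} (1<a , a∣a) =
    let p , p-prime , p∣a₀ = primeFactor (1<a zero)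
    in record { p = p ; p-prime = p-prime ; p∣a = λ i → ℕ∣.∣-trans p∣a₀ (a∣a zero i z≤n) }

theorem2p4 : ∀ {n} (G : Graph n) → Connected G →
    (Z : Subset n) → Nonempty Z →
    (d r : Fin n → ℕ) → IsArithmetical G d r →
    (∀ (δ : Fin n → ℤ) → ∃[ δ' ] (SupportedOn δ' Z × (δ ≈[ G , d ] δ'))) →
    ∀ (k : ℕ) (a : Fin k → ℕ) → IsInvariantFactors a → CritIso G d a →
    k ≤ ∣ Z ∣ ∸ 1
theorem2p4 G _ Z _ d r arithmetical reduce k a factors iso =
  ∸-monoˡ-≤ 1 (rank-bound arithmetical iso p-prime p∣a Z reduce)
  where open CommonPrimeFactor (commonPrimeFactor factors)
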